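{- For $N\ge1$ and integers $\Sigma_1,\Sigma_2\ge0$, $n\ge1$, let $a_N(\Sigma_1,\Sigma_2;n)$ be the number of partitions of $n$ with exactly $N$ positive parts, in which every part occurs at most twice, and whose alternating sum type (modulus $3$) is $(\Sigma_1,\Sigma_2)$. Define the formal power series $A_0(x,y,q)=1$ and, for $N\ge1$, $$A_N(x,y,q)=\sum_{\Sigma_1\ge0}\sum_{\Sigma_2\ge0}\sum_{n\ge1}a_N(\Sigma_1,\Sigma_2;n)x^{\Sigma_1}y^{\Sigma_2}q^n.$$ Then for all $N\ge1$: $$A_{3N}=\big(A_{3N-1}+A_{3N-2}\big)\frac{q^{3N}}{1-q^{3N}},\quad A_{3N+1}=\big(A_{3N}+A_{3N-1}\big)\frac{xq^{3N+1}}{1-xq^{3N+1}},\quad A_{3N+2}=\big(A_{3N+1}+A_{3N}\big)\frac{yq^{3N+2}}{1-yq^{3N+2}}.$$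
   Context: For a partition $\lambda_1\ge\dots\ge\lambda_r>0$, append zero parts so that its length becomes a multiple $3k$ of $3$. Its alternating sum type (modulus 3) is $(\Sigma_1,\Sigma_2)$ with $\Sigma_1=\sum_{i=1}^k(\lambda_{3i-2}-\lambda_{3i-1})$ and $\Sigma_2=\sum_{i=1}^k(\lambda_{3i-1}-\lambda_{3i})$. -}

module Defs where

open import Data.Nat using (ℕ; zero; suc; _+_; _*_; _∸_; _≤_; _≟_; _≥?_; _≤?_)
open import Data.Nat.Properties using (≤-decTotalOrder)
open import Data.List using (List; []; _∷_; map; concatMap; filter; length; upTo)
open import Data.Nat.ListAction using (sum)
open import Data.Bool using (if_then_else_)
open import Relation.Nullary using (does)
open import Data.List.Relation.Unary.Linked using (Linked; linked?)
open import Data.List.Relation.Unary.All using (All; all?)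
open import Data.Product using (_×_; _,_)
open import Relation.Binary.PropositionalEquality using (_≡_)
open import Relation.Nullary using (Dec)
open import Relation.Nullary.Decidable using (_×-dec_)
import Data.Nat as N

range1 : ℕ → List ℕ
range1 n = map suc (upTo n)

lists : ℕ → ℕ → List (List ℕ)
lists zero    n = [] ∷ []
lists (suc k) n = concatMap (λ x → map (x ∷_) (lists k n)) (range1 n)

-- a partition with N positive parts, written as its list of parts λ₁ ≥ … ≥ λ_N
NonIncreasing : List ℕ → Set
NonIncreasing = Linked N._≥_

occ : ℕ → List ℕ → ℕ
occ x l = length (filter (x ≟_) l)

AtMostTwice : List ℕ → Set
AtMostTwice l = All (λ x → occ x l ≤ 2) l

-- alternating sum type (modulus 3), padding with zero parts to length ≡ 0 mod 3:
-- (Σ₁, Σ₂) = (Σ (λ_{3i-2} - λ_{3i-1}), Σ (λ_{3i-1} - λ_{3i}))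
-- (truncated subtraction is exact since parts are non-increasing)
altType : List ℕ → ℕ × ℕ
altType []               = 0 , 0
altType (a ∷ [])         = a , 0
altType (a ∷ b ∷ [])     = a ∸ b , b
altType (a ∷ b ∷ c ∷ l) with altType l
... | s₁ , s₂ = (a ∸ b) + s₁ , (b ∸ c) + s₂

-- the defining property of partitions counted by a_N(Σ₁,Σ₂;n), for a list of length N
-- with positive entries
Good : ℕ → ℕ → ℕ → List ℕ → Set
Good s₁ s₂ n l = NonIncreasing l × (sum l ≡ n × (AtMostTwice l × altType l ≡ (s₁ , s₂)))

good? : ∀ s₁ s₂ n l → Dec (Good s₁ s₂ n l)
good? s₁ s₂ n l =
  linked? (λ x y → y ≤? x) l ×-dec
  ((sum l ≟ n) ×-dec
   (all? (λ x → occ x l ≤? 2) l ×-dec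
    (Data.Product.Properties.≡-dec _≟_ _≟_ (altType l) (s₁ , s₂))))
  where import Data.Product.Properties

a : ℕ → ℕ → ℕ → ℕ → ℕ
a N s₁ s₂ n = length (filter (good? s₁ s₂ n) (lists N n))

-- formal power series in x, y, q with ℕ coefficients:
-- F i j n = coefficient of x^i y^j q^n
Series : Set
Series = ℕ → ℕ → ℕ → ℕ

_≈_ : Series → Series → Set
F ≈ G = ∀ i j n → F i j n ≡ G i j n

_⊕_ : Series → Series → Series
(F ⊕ G) i j n = F i j n + G i j n

Σ≤ : ℕ → (ℕ → ℕ) → ℕ
Σ≤ m f = sum (map f (upTo (suc m)))

_⊛_ : Series → Series → Series
(F ⊛ G) i j n =
  Σ≤ i λ i₁ → Σ≤ j λ j₁ → Σ≤ n λ n₁ → F i₁ j₁ n₁ * G (i ∸ i₁) (j ∸ j₁) (n ∸ n₁)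

[_] : ∀ {P : Set} → Dec P → ℕ
[ d ] = if does d then 1 else 0

-- for c ≥ 1, the series t/(1-t) = Σ_{k≥1} t^k with t = x^α y^β q^c.
-- Coefficient of x^i y^j q^n: number of k ≥ 1 with (kα,kβ,kc) = (i,j,n);
-- such k satisfies k ≤ kc = n, so it suffices to range over k ∈ {1,…,n}.
geom : ℕ → ℕ → ℕ → Series
geom α β c i j n =
  sum (map (λ k → [ (k * α ≟ i) ×-dec ((k * β ≟ j) ×-dec (k * c ≟ n)) ]) (range1 n))

A : ℕ → Series
A zero    zero    zero    zero    = 1
A zero    _       _       _       = 0
A (suc N) s₁ s₂ zero    = 0
A (suc N) s₁ s₂ (suc n) = a (suc N) s₁ s₂ (suc n)

-- Let λ be a partition with m ≥ 3 parts, each occurring at most twice, and let k be its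
-- smallest part, occurring r ∈ {1, 2} times. Subtracting k from every part and dropping the
-- r zeros leaves a partition μ of the same kind with m − r parts, and (k, μ) determines λ.
-- Adding k to each of m parts adds k·m to the size and changes the alternating sum type by
-- (0,0), (k,0) or (0,k) according as m ≡ 0, 1, 2 (mod 3), i.e. by (kα, kβ). So λ ↦ (k, μ) is a
-- bijection under which the weight is multiplied by t^k, t = x^α y^β q^m, and summing over
-- k ≥ 1 gives A_m = (A_{m−1} + A_{m−2}) · t/(1 − t). Coefficients are counts over the explicit
-- enumerations, and the bijection becomes an equality of counts by double counting.

module Submission where

open import Defs
open import Data.Nat using (ℕ; zero; suc; >-nonZero; _+_; _*_; _∸_; _≤_; _<_; z≤n; s≤s; _≟_; _≤?_)
open import Data.Nat.Properties
open import Data.Nat.ListAction using (sum)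
open import Data.Nat.ListAction.Properties using (sum-++)
open import Data.Product using (_×_; _,_; proj₁; proj₂; ∃-syntax)
open import Data.Product.Properties using () renaming (≡-dec to ×-≡-dec)
open import Data.Sum using (_⊎_; inj₁; inj₂; [_,_]′)
open import Data.Empty using (⊥-elim)
open import Data.List.Relation.Unary.All using (All; []; _∷_)
import Data.List.Relation.Unary.All as All
import Data.List.Relation.Unary.All.Properties as All
open import Data.List.Relation.Unary.Linked using ([]; [-]; _∷_)
import Data.List.Relation.Unary.Linked as Linked
import Data.List.Relation.Unary.Linked.Properties as Linked
open import Data.List.Relation.Unary.Any using (Any; here; there)
open import Function using (_∘_)
open import Data.List using (List; []; _∷_; map; filter; length; upTo; applyUpTo; _++_; replicate; concatMap)
open import Data.List.Properties using (filter-++; filter-all; filter-none; ≡-dec; ∷-injective; map-∘; map-++; map-cong-local; map-replicate; length-map; length-++; length-replicate; ++-assoc; ++-identityʳ)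
open import Relation.Binary.PropositionalEquality hiding ([_])
open import Relation.Binary.Definitions using (DecidableEquality)
open import Relation.Nullary using (Dec; yes; no; ¬_)
open import Relation.Nullary.Decidable using (_×-dec_)
open import Data.Nat.Tactic.RingSolver using (solve-∀)
open import Algebra.Properties.CommutativeSemigroup +-commutativeSemigroup using (interchange)

-- Counting with indicators

indicator-yes : ∀ {P : Set} (d : Dec P) → P → [ d ] ≡ 1
indicator-yes (yes _) _ = refl
indicator-yes (no ¬p) p = ⊥-elim (¬p p)

indicator-no : ∀ {P : Set} (d : Dec P) → ¬ P → [ d ] ≡ 0
indicator-no (yes p) ¬p = ⊥-elim (¬p p)
indicator-no (no _)  _  = refl

indicator-× : ∀ {P Q : Set} (d : Dec P) (e : Dec Q) → [ d ×-dec e ] ≡ [ d ] * [ e ]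
indicator-× (yes _) (yes _) = refl
indicator-× (yes _) (no _)  = refl
indicator-× (no _)  _       = refl

indicator-cong : ∀ {P Q : Set} (d : Dec P) (e : Dec Q) → (P → Q) → (Q → P) → [ d ] ≡ [ e ]
indicator-cong (yes _) (yes _) _ _ = refl
indicator-cong (yes p) (no ¬q) f _ = ⊥-elim (¬q (f p))
indicator-cong (no ¬p) (yes q) _ g = ⊥-elim (¬p (g q))
indicator-cong (no _)  (no _)  _ _ = refl

length-filter-as-sum : ∀ {A : Set} {P : A → Set} (P? : ∀ x → Dec (P x)) (xs : List A) →
  length (filter P? xs) ≡ sum (map (λ x → [ P? x ]) xs)
length-filter-as-sum P? [] = refl
length-filter-as-sum P? (x ∷ xs) with P? x
... | yes _ = cong suc (length-filter-as-sum P? xs)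
... | no _  = length-filter-as-sum P? xs

∑< : ℕ → (ℕ → ℕ) → ℕ
∑< zero    f = 0
∑< (suc n) f = f 0 + ∑< n (λ k → f (suc k))

syntax ∑< n (λ k → e) = ∑[ k < n ] e

∑<-cong : ∀ n {f g : ℕ → ℕ} → (∀ k → k < n → f k ≡ g k) → ∑< n f ≡ ∑< n g
∑<-cong zero    _ = refl
∑<-cong (suc n) e = cong₂ _+_ (e 0 (s≤s z≤n)) (∑<-cong n (λ k k<n → e (suc k) (s≤s k<n)))

∑<-zero : ∀ n {f : ℕ → ℕ} → (∀ k → k < n → f k ≡ 0) → ∑< n f ≡ 0
∑<-zero zero    _ = refl
∑<-zero (suc n) z = cong₂ _+_ (z 0 (s≤s z≤n)) (∑<-zero n (λ k k<n → z (suc k) (s≤s k<n)))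

∑<-distrib-+ : ∀ n (f g : ℕ → ℕ) → ∑[ k < n ] (f k + g k) ≡ ∑< n f + ∑< n g
∑<-distrib-+ zero    f g = refl
∑<-distrib-+ (suc n) f g = trans (cong (f 0 + g 0 +_) (∑<-distrib-+ n _ _)) (interchange (f 0) (g 0) _ _)

*-distribˡ-∑< : ∀ n c (f : ℕ → ℕ) → c * ∑< n f ≡ ∑[ k < n ] (c * f k)
*-distribˡ-∑< zero    c f = *-zeroʳ c
*-distribˡ-∑< (suc n) c f = trans (*-distribˡ-+ c (f 0) _) (cong (c * f 0 +_) (*-distribˡ-∑< n c _))

∑<-comm : ∀ m n (f : ℕ → ℕ → ℕ) → ∑[ a < m ] ∑[ b < n ] f a b ≡ ∑[ b < n ] ∑[ a < m ] f a b
∑<-comm zero    n f = sym (∑<-zero n (λ _ _ → refl))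
∑<-comm (suc m) n f = trans (cong (∑< n (f 0) +_) (∑<-comm m n (λ a → f (suc a))))
                            (sym (∑<-distrib-+ n (f 0) _))

∑<-pick : ∀ n t {f : ℕ → ℕ} → t < n → (∀ k → k < n → k ≢ t → f k ≡ 0) → ∑< n f ≡ f t
∑<-pick (suc n) zero    _ z = trans (cong (_ +_) (∑<-zero n (λ k k<n → z (suc k) (s≤s k<n) (λ ()))))
                                    (+-identityʳ _)
∑<-pick (suc n) (suc t) {f} (s≤s t<n) z =
  trans (cong (_+ ∑[ k < n ] f (suc k)) (z 0 (s≤s z≤n) (λ ())))
        (∑<-pick n t t<n (λ k k<n k≢t → z (suc k) (s≤s k<n) (k≢t ∘ suc-injective)))

∑<-pick-suc : ∀ n t c → 1 ≤ t → t ≤ n → ∑[ k < n ] ([ suc k ≟ t ] * c) ≡ c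
∑<-pick-suc n (suc t) c _ t<n =
  trans (∑<-pick n t t<n (λ k _ k≢t → cong (_* c) (indicator-no (suc k ≟ suc t) (k≢t ∘ suc-injective))))
        (trans (cong (_* c) (indicator-yes (suc t ≟ suc t) refl)) (+-identityʳ c))

∑<-extend : ∀ m n {f : ℕ → ℕ} → m ≤ n → (∀ k → m ≤ k → k < n → f k ≡ 0) → ∑< m f ≡ ∑< n f
∑<-extend zero    n       _         z = sym (∑<-zero n (λ k → z k z≤n))
∑<-extend (suc m) (suc n) (s≤s m≤n) z =
  cong (_ +_) (∑<-extend m n m≤n (λ k m≤k k<n → z (suc k) (s≤s m≤k) (s≤s k<n)))

∑<-pick-∸ : ∀ m d (h : ℕ → ℕ) → ∑[ x < suc m ] ([ d ≟ m ∸ x ] * h x) ≡ [ d ≤? m ] * h (m ∸ d)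
∑<-pick-∸ m d h with d ≤? m
... | yes d≤m = trans (∑<-pick (suc m) (m ∸ d) (s≤s (m∸n≤m m d)) others)
                      (cong (_* h (m ∸ d)) (trans (indicator-yes (d ≟ m ∸ (m ∸ d)) (sym (m∸[m∸n]≡n d≤m)))
                                                  (sym (indicator-yes (d ≤? m) d≤m))))
  where
  others : ∀ x → x < suc m → x ≢ m ∸ d → [ d ≟ m ∸ x ] * h x ≡ 0
  others x (s≤s x≤m) x≢ = cong (_* h x) (indicator-no (d ≟ m ∸ x)
    (λ d≡ → x≢ (trans (sym (m∸[m∸n]≡n x≤m)) (cong (m ∸_) (sym d≡)))))
... | no d≰m = trans (∑<-zero (suc m) (λ x _ → cong (_* h x) (indicator-no (d ≟ m ∸ x)
                        (λ d≡ → d≰m (≤-trans (≤-reflexive d≡) (m∸n≤m m x))))))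
                     (sym (cong (_* h (m ∸ d)) (indicator-no (d ≤? m) d≰m)))

sum-map-cong : ∀ {A : Set} {P : A → Set} {f g : A → ℕ} {xs : List A} →
  All P xs → (∀ x → P x → f x ≡ g x) → sum (map f xs) ≡ sum (map g xs)
sum-map-cong Pxs e = cong sum (map-cong-local (All.map (e _) Pxs))

sum-map-zero : ∀ {A : Set} {f : A → ℕ} (xs : List A) → (∀ x → f x ≡ 0) → sum (map f xs) ≡ 0
sum-map-zero []       _ = refl
sum-map-zero (x ∷ xs) z = cong₂ _+_ (z x) (sum-map-zero xs z)

sum-map-distrib-+ : ∀ {A : Set} (f g : A → ℕ) (xs : List A) →
  sum (map (λ x → f x + g x) xs) ≡ sum (map f xs) + sum (map g xs)
sum-map-distrib-+ f g []       = refl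
sum-map-distrib-+ f g (x ∷ xs) =
  trans (cong (f x + g x +_) (sum-map-distrib-+ f g xs)) (interchange (f x) (g x) _ _)

*-distribˡ-sum-map : ∀ {A : Set} c (f : A → ℕ) (xs : List A) →
  c * sum (map f xs) ≡ sum (map (λ x → c * f x) xs)
*-distribˡ-sum-map c f []       = *-zeroʳ c
*-distribˡ-sum-map c f (x ∷ xs) = trans (*-distribˡ-+ c (f x) _) (cong (c * f x +_) (*-distribˡ-sum-map c f xs))

sum-map-comm : ∀ {A B : Set} (xs : List A) (ys : List B) (φ : A → B → ℕ) →
  sum (map (λ x → sum (map (φ x) ys)) xs) ≡ sum (map (λ y → sum (map (λ x → φ x y) xs)) ys)
sum-map-comm []       ys φ = sym (sum-map-zero ys (λ _ → refl))
sum-map-comm (x ∷ xs) ys φ = trans (cong (sum (map (φ x) ys) +_) (sum-map-comm xs ys φ))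
                                   (sym (sum-map-distrib-+ (φ x) _ ys))

sum-map-++ : ∀ {A : Set} (h : A → ℕ) (xs ys : List A) →
  sum (map h (xs ++ ys)) ≡ sum (map h xs) + sum (map h ys)
sum-map-++ h xs ys = trans (cong sum (map-++ h xs ys)) (sum-++ (map h xs) (map h ys))

sum-map-concatMap : ∀ {A B : Set} (h : B → ℕ) (φ : A → List B) (xs : List A) →
  sum (map h (concatMap φ xs)) ≡ sum (map (λ x → sum (map h (φ x))) xs)
sum-map-concatMap h φ []       = refl
sum-map-concatMap h φ (x ∷ xs) =
  trans (sum-map-++ h (φ x) (concatMap φ xs)) (cong (sum (map h (φ x)) +_) (sum-map-concatMap h φ xs))

sum-map-∘ : ∀ {A B : Set} (h : B → ℕ) (φ : A → B) (xs : List A) →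
  sum (map h (map φ xs)) ≡ sum (map (h ∘ φ) xs)
sum-map-∘ h φ xs = cong sum (sym (map-∘ xs))

sum-map-applyUpTo : ∀ (f g : ℕ → ℕ) n → sum (map f (applyUpTo g n)) ≡ ∑< n (f ∘ g)
sum-map-applyUpTo f g zero    = refl
sum-map-applyUpTo f g (suc n) = cong (f (g 0) +_) (sum-map-applyUpTo f (g ∘ suc) n)

sum-map-range1 : ∀ (f : ℕ → ℕ) n → sum (map f (range1 n)) ≡ ∑< n (f ∘ suc)
sum-map-range1 f n = trans (sum-map-∘ f suc (upTo n)) (sum-map-applyUpTo (f ∘ suc) (λ k → k) n)

Σ≤≡∑< : ∀ m f → Σ≤ m f ≡ ∑< (suc m) f
Σ≤≡∑< m f = sum-map-applyUpTo f (λ k → k) (suc m)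

multiplicity : ∀ {A : Set} → DecidableEquality A → List A → A → ℕ
multiplicity _≟ᴬ_ xs y = sum (map (λ x → [ x ≟ᴬ y ]) xs)

-- Double counting of the pairs (x , y) with y ≡ f x, equivalently x ≡ g y.
count-bijection : ∀ {A B : Set} (_≟ᴬ_ : DecidableEquality A) (_≟ᴮ_ : DecidableEquality B)
  {InE : A → Set} {InF : B → Set} {E : List A} {F : List B} → All InE E → All InF F →
  {P : A → Set} {Q : B → Set} (P? : ∀ x → Dec (P x)) (Q? : ∀ y → Dec (Q y)) (f : A → B) (g : B → A) →
  (∀ x → InE x → P x → Q (f x) × g (f x) ≡ x × multiplicity _≟ᴮ_ F (f x) ≡ 1) →
  (∀ y → InF y → Q y → P (g y) × f (g y) ≡ y × multiplicity _≟ᴬ_ E (g y) ≡ 1) →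
  sum (map (λ x → [ P? x ]) E) ≡ sum (map (λ y → [ Q? y ]) F)
count-bijection _≟ᴬ_ _≟ᴮ_ {InE} {InF} {E} {F} E-in F-in {P} {Q} P? Q? f g fwd bwd = begin
  sum (map (λ x → [ P? x ]) E)
    ≡⟨ sum-map-cong E-in spreadᴱ ⟩
  sum (map (λ x → [ P? x ] * multiplicity _≟ᴮ_ F (f x)) E)
    ≡⟨ cong sum (map-cong-local (All.universal (λ x → *-distribˡ-sum-map [ P? x ] _ F) E)) ⟩
  sum (map (λ x → sum (map (λ y → [ P? x ] * [ y ≟ᴮ f x ]) F)) E)
    ≡⟨ sum-map-comm E F _ ⟩
  sum (map (λ y → sum (map (λ x → [ P? x ] * [ y ≟ᴮ f x ]) E)) F)
    ≡⟨ sum-map-cong F-in (λ y inF → sum-map-cong E-in (λ x inE → edge x y inE inF)) ⟩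
  sum (map (λ y → sum (map (λ x → [ Q? y ] * [ x ≟ᴬ g y ]) E)) F)
    ≡⟨ cong sum (map-cong-local (All.universal (λ y → sym (*-distribˡ-sum-map [ Q? y ] _ E)) F)) ⟩
  sum (map (λ y → [ Q? y ] * multiplicity _≟ᴬ_ E (g y)) F)
    ≡⟨ sum-map-cong F-in (λ y inF → sym (spreadᶠ y inF)) ⟩
  sum (map (λ y → [ Q? y ]) F) ∎
  where
  open ≡-Reasoning
  spreadᴱ : ∀ x → InE x → [ P? x ] ≡ [ P? x ] * multiplicity _≟ᴮ_ F (f x)
  spreadᴱ x inE with P? x
  ... | yes p = sym (cong (1 *_) (proj₂ (proj₂ (fwd x inE p))))
  ... | no _  = refl
  spreadᶠ : ∀ y → InF y → [ Q? y ] ≡ [ Q? y ] * multiplicity _≟ᴬ_ E (g y)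
  spreadᶠ y inF with Q? y
  ... | yes q = sym (cong (1 *_) (proj₂ (proj₂ (bwd y inF q))))
  ... | no _  = refl
  edge : ∀ x y → InE x → InF y → [ P? x ] * [ y ≟ᴮ f x ] ≡ [ Q? y ] * [ x ≟ᴬ g y ]
  edge x y inE inF with P? x | Q? y | y ≟ᴮ f x | x ≟ᴬ g y
  ... | yes p | _     | yes refl | no x≢ = ⊥-elim (x≢ (sym (proj₁ (proj₂ (fwd x inE p)))))
  ... | yes p | no ¬q | yes refl | _     = ⊥-elim (¬q (proj₁ (fwd x inE p)))
  ... | _     | yes q | no y≢   | yes refl = ⊥-elim (y≢ (sym (proj₁ (proj₂ (bwd y inF q)))))
  ... | no ¬p | yes q | _       | yes refl = ⊥-elim (¬p (proj₁ (bwd y inF q)))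
  ... | yes _ | yes _ | yes _   | yes _ = refl
  ... | yes _ | yes _ | no _    | no _  = refl
  ... | yes _ | no _  | no _    | _     = refl
  ... | no _  | yes _ | _       | no _  = refl
  ... | no _  | no _  | _       | _     = refl

-- The enumeration of lists

_≟ᴸ_ : DecidableEquality (List ℕ)
_≟ᴸ_ = ≡-dec _≟_

InLists : ℕ → ℕ → List ℕ → Set
InLists N n z = length z ≡ N × All (λ e → 1 ≤ e × e ≤ n) z

lists-sound : ∀ N n → All (InLists N n) (lists N n)
lists-sound zero    n = (refl , []) ∷ []
lists-sound (suc N) n =
  All.concat⁺ (All.map⁺ (All.map⁺ (All.applyUpTo⁺₁ (λ k → k) n (λ k<n →
    All.map⁺ (All.map (λ (len , entries) → cong suc len , (s≤s z≤n , k<n) ∷ entries) (lists-sound N n))))))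

sum-map-lists-suc : ∀ N n (h : List ℕ → ℕ) →
  sum (map h (lists (suc N) n)) ≡ ∑[ k < n ] sum (map (λ l → h (suc k ∷ l)) (lists N n))
sum-map-lists-suc N n h =
  trans (sum-map-concatMap h (λ x → map (x ∷_) (lists N n)) (range1 n))
  (trans (sum-map-range1 _ n) (∑<-cong n (λ k _ → sum-map-∘ h (suc k ∷_) (lists N n))))

indicator-∷ : ∀ x l e z → [ (x ∷ l) ≟ᴸ (e ∷ z) ] ≡ [ x ≟ e ] * [ l ≟ᴸ z ]
indicator-∷ x l e z = trans (indicator-cong ((x ∷ l) ≟ᴸ (e ∷ z)) ((x ≟ e) ×-dec (l ≟ᴸ z)) ∷-injective
                                             (λ { (refl , refl) → refl }))
                            (indicator-× (x ≟ e) (l ≟ᴸ z))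

multiplicity-lists-suc : ∀ N n e z →
  multiplicity _≟ᴸ_ (lists (suc N) n) (e ∷ z) ≡ ∑[ k < n ] ([ suc k ≟ e ] * multiplicity _≟ᴸ_ (lists N n) z)
multiplicity-lists-suc N n e z = trans (sum-map-lists-suc N n _) (∑<-cong n (λ k _ →
  trans (cong sum (map-cong-local (All.universal (λ l → indicator-∷ (suc k) l e z) (lists N n))))
        (sym (*-distribˡ-sum-map [ suc k ≟ e ] _ (lists N n)))))

multiplicity-lists : ∀ N n z → InLists N n z → multiplicity _≟ᴸ_ (lists N n) z ≡ 1
multiplicity-lists zero    n []      _ = refl
multiplicity-lists (suc N) n (e ∷ z) (len , (1≤e , e≤n) ∷ entries) =
  trans (multiplicity-lists-suc N n e z)
  (trans (∑<-cong n (λ k _ → cong ([ suc k ≟ e ] *_) (multiplicity-lists N n z (suc-injective len , entries))))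
         (∑<-pick-suc n e 1 1≤e e≤n))

multiplicity-lists-length : ∀ N n z → length z ≢ N → multiplicity _≟ᴸ_ (lists N n) z ≡ 0
multiplicity-lists-length zero    n []      len≢ = ⊥-elim (len≢ refl)
multiplicity-lists-length zero    n (e ∷ z) _    = refl
multiplicity-lists-length (suc N) n []      _    =
  trans (sum-map-lists-suc N n _) (∑<-zero n (λ _ _ → sum-map-zero (lists N n) (λ _ → refl)))
multiplicity-lists-length (suc N) n (e ∷ z) len≢ =
  trans (multiplicity-lists-suc N n e z) (∑<-zero n (λ k _ →
    trans (cong ([ suc k ≟ e ] *_) (multiplicity-lists-length N n z (len≢ ∘ cong suc))) (*-zeroʳ [ suc k ≟ e ])))

sum-map-lists-shrink : ∀ N {n′ n} (h : List ℕ → ℕ) → n′ ≤ n → (∀ z → Any (n′ <_) z → h z ≡ 0) →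
  sum (map h (lists N n)) ≡ sum (map h (lists N n′))
sum-map-lists-shrink zero    h _ _ = refl
sum-map-lists-shrink (suc N) {n′} {n} h n′≤n large = begin
  sum (map h (lists (suc N) n))
    ≡⟨ sum-map-lists-suc N n h ⟩
  ∑[ k < n ] sum (map (λ l → h (suc k ∷ l)) (lists N n))
    ≡⟨ ∑<-extend n′ n n′≤n (λ k n′≤k _ → sum-map-zero (lists N n) (λ l → large (suc k ∷ l) (here (s≤s n′≤k))))
       ⟨
  ∑[ k < n′ ] sum (map (λ l → h (suc k ∷ l)) (lists N n))
    ≡⟨ ∑<-cong n′ (λ k _ → sum-map-lists-shrink N _ n′≤n (λ z → large (suc k ∷ z) ∘ there)) ⟩
  ∑[ k < n′ ] sum (map (λ l → h (suc k ∷ l)) (lists N n′))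
    ≡⟨ sum-map-lists-suc N n′ h ⟨
  sum (map h (lists (suc N) n′)) ∎
  where open ≡-Reasoning

parts≤sum : ∀ l → All (_≤ sum l) l
parts≤sum []      = []
parts≤sum (a ∷ l) = m≤m+n a (sum l) ∷ All.map (λ p → ≤-trans p (m≤n+m (sum l) a)) (parts≤sum l)

Good⇒¬Any> : ∀ {i j n l} → Good i j n l → ¬ Any (n <_) l
Good⇒¬Any> {l = l} (_ , sum≡n , _) =
  All.All¬⇒¬Any (All.map (λ p q → <⇒≱ q p) (subst (λ s → All (_≤ s) l) sum≡n (parts≤sum l)))

A-suc≡a : ∀ m i j n → A (suc m) i j n ≡ a (suc m) i j n
A-suc≡a m i j zero    = refl
A-suc≡a m i j (suc n) = refl

A-suc-count : ∀ m i j {n′ n} → n′ ≤ n → A (suc m) i j n′ ≡ sum (map (λ l → [ good? i j n′ l ]) (lists (suc m) n))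
A-suc-count m i j {n′} {n} n′≤n = begin
  A (suc m) i j n′                                             ≡⟨ A-suc≡a m i j n′ ⟩
  length (filter (good? i j n′) (lists (suc m) n′))            ≡⟨ length-filter-as-sum (good? i j n′) (lists (suc m) n′) ⟩
  sum (map (λ l → [ good? i j n′ l ]) (lists (suc m) n′))      ≡⟨ sum-map-lists-shrink (suc m) _ n′≤n large ⟨
  sum (map (λ l → [ good? i j n′ l ]) (lists (suc m) n)) ∎
  where
  open ≡-Reasoning
  large : ∀ z → Any (n′ <_) z → [ good? i j n′ z ] ≡ 0
  large z has-large = indicator-no (good? i j n′ z) (λ G → Good⇒¬Any> G has-large)

-- Multiplication by t/(1 − t)

monomial : ℕ → ℕ → ℕ → Series
monomial a b c i j n = [ a ≟ i ] * ([ b ≟ j ] * [ c ≟ n ])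

-- The coefficients of x^a y^b q^c · B; the truncated subtractions are guarded by the indicators.
shift : Series → ℕ → ℕ → ℕ → Series
shift B a b c i j n = [ a ≤? i ] * ([ b ≤? j ] * ([ c ≤? n ] * B (i ∸ a) (j ∸ b) (n ∸ c)))

⊛-as-∑< : ∀ F G i j n → (F ⊛ G) i j n ≡
  ∑[ i₁ < suc i ] ∑[ j₁ < suc j ] ∑[ n₁ < suc n ] (F i₁ j₁ n₁ * G (i ∸ i₁) (j ∸ j₁) (n ∸ n₁))
⊛-as-∑< F G i j n =
  trans (Σ≤≡∑< i (λ i₁ → Σ≤ j λ j₁ → Σ≤ n λ n₁ → term i₁ j₁ n₁)) (∑<-cong (suc i) (λ i₁ _ →
  trans (Σ≤≡∑< j (λ j₁ → Σ≤ n λ n₁ → term i₁ j₁ n₁)) (∑<-cong (suc j) (λ j₁ _ → Σ≤≡∑< n (term i₁ j₁)))))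
  where
  term : ℕ → ℕ → ℕ → ℕ
  term i₁ j₁ n₁ = F i₁ j₁ n₁ * G (i ∸ i₁) (j ∸ j₁) (n ∸ n₁)

⊛-monomial : ∀ B a b c i j n → (B ⊛ monomial a b c) i j n ≡ shift B a b c i j n
⊛-monomial B a b c i j n = begin
  (B ⊛ monomial a b c) i j n
    ≡⟨ ⊛-as-∑< B (monomial a b c) i j n ⟩
  ∑[ i₁ < suc i ] ∑[ j₁ < suc j ] ∑[ n₁ < suc n ] (B i₁ j₁ n₁ * ([ a ≟ i ∸ i₁ ] * ([ b ≟ j ∸ j₁ ] * [ c ≟ n ∸ n₁ ])))
    ≡⟨ ∑<-cong (suc i) (λ i₁ _ → ∑<-cong (suc j) (λ j₁ _ →
         trans (∑<-cong (suc n) (λ n₁ _ → rearrange (B i₁ j₁ n₁) [ a ≟ i ∸ i₁ ] [ b ≟ j ∸ j₁ ] [ c ≟ n ∸ n₁ ]))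
               (∑<-pick-∸ n c (λ n₁ → [ a ≟ i ∸ i₁ ] * ([ b ≟ j ∸ j₁ ] * B i₁ j₁ n₁))))) ⟩
  ∑[ i₁ < suc i ] ∑[ j₁ < suc j ] ([ c ≤? n ] * ([ a ≟ i ∸ i₁ ] * ([ b ≟ j ∸ j₁ ] * B i₁ j₁ (n ∸ c))))
    ≡⟨ ∑<-cong (suc i) (λ i₁ _ →
         trans (∑<-cong (suc j) (λ j₁ _ → rotate [ c ≤? n ] [ a ≟ i ∸ i₁ ] [ b ≟ j ∸ j₁ ] (B i₁ j₁ (n ∸ c))))
               (∑<-pick-∸ j b (λ j₁ → [ c ≤? n ] * ([ a ≟ i ∸ i₁ ] * B i₁ j₁ (n ∸ c))))) ⟩
  ∑[ i₁ < suc i ] ([ b ≤? j ] * ([ c ≤? n ] * ([ a ≟ i ∸ i₁ ] * B i₁ (j ∸ b) (n ∸ c))))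
    ≡⟨ trans (∑<-cong (suc i) (λ i₁ _ → rotate [ b ≤? j ] [ c ≤? n ] [ a ≟ i ∸ i₁ ] (B i₁ (j ∸ b) (n ∸ c))))
             (∑<-pick-∸ i a (λ i₁ → [ b ≤? j ] * ([ c ≤? n ] * B i₁ (j ∸ b) (n ∸ c)))) ⟩
  shift B a b c i j n ∎
  where
  open ≡-Reasoning
  rearrange : ∀ w x y z → w * (x * (y * z)) ≡ z * (x * (y * w))
  rearrange = solve-∀
  rotate : ∀ w x y z → w * (x * (y * z)) ≡ y * (w * (x * z))
  rotate = solve-∀

geom-as-∑< : ∀ α β c → 1 ≤ c → ∀ {n′} n i j → n′ ≤ n →
  geom α β c i j n′ ≡ ∑[ k < n ] monomial (suc k * α) (suc k * β) (suc k * c) i j n′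
geom-as-∑< α β c 1≤c {n′} n i j n′≤n = begin
  geom α β c i j n′
    ≡⟨ sum-map-range1 _ n′ ⟩
  ∑[ k < n′ ] [ (suc k * α ≟ i) ×-dec ((suc k * β ≟ j) ×-dec (suc k * c ≟ n′)) ]
    ≡⟨ ∑<-cong n′ (λ k _ → trans (indicator-× (suc k * α ≟ i) ((suc k * β ≟ j) ×-dec (suc k * c ≟ n′)))
                                  (cong ([ suc k * α ≟ i ] *_) (indicator-× (suc k * β ≟ j) (suc k * c ≟ n′)))) ⟩
  ∑[ k < n′ ] monomial (suc k * α) (suc k * β) (suc k * c) i j n′
    ≡⟨ ∑<-extend n′ n n′≤n beyond ⟩
  ∑[ k < n ] monomial (suc k * α) (suc k * β) (suc k * c) i j n′ ∎
  where
  open ≡-Reasoning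
  beyond : ∀ k → n′ ≤ k → k < n → monomial (suc k * α) (suc k * β) (suc k * c) i j n′ ≡ 0
  beyond k n′≤k _ =
    trans (cong (λ t → [ suc k * α ≟ i ] * ([ suc k * β ≟ j ] * t)) (indicator-no (suc k * c ≟ n′) too-large))
          (trans (cong ([ suc k * α ≟ i ] *_) (*-zeroʳ [ suc k * β ≟ j ])) (*-zeroʳ [ suc k * α ≟ i ]))
    where
    too-large : suc k * c ≢ n′
    too-large e = <⇒≱ (s≤s n′≤k) (≤-trans (m≤m*n (suc k) c ⦃ >-nonZero 1≤c ⦄) (≤-reflexive e))

⊛-geom : ∀ B α β c → 1 ≤ c → ∀ i j n →
  (B ⊛ geom α β c) i j n ≡ ∑[ k < n ] shift B (suc k * α) (suc k * β) (suc k * c) i j n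
⊛-geom B α β c 1≤c i j n = begin
  (B ⊛ geom α β c) i j n
    ≡⟨ ⊛-as-∑< B (geom α β c) i j n ⟩
  ∑[ i₁ < suc i ] ∑[ j₁ < suc j ] ∑[ n₁ < suc n ] (B i₁ j₁ n₁ * geom α β c (i ∸ i₁) (j ∸ j₁) (n ∸ n₁))
    ≡⟨ ∑<-cong (suc i) (λ i₁ _ → ∑<-cong (suc j) (λ j₁ _ → ∑<-cong (suc n) (λ n₁ _ →
         trans (cong (B i₁ j₁ n₁ *_) (geom-as-∑< α β c 1≤c n (i ∸ i₁) (j ∸ j₁) (m∸n≤m n n₁)))
               (*-distribˡ-∑< n (B i₁ j₁ n₁) (λ k → monomial-k k (i ∸ i₁) (j ∸ j₁) (n ∸ n₁)))))) ⟩
  ∑[ i₁ < suc i ] ∑[ j₁ < suc j ] ∑[ n₁ < suc n ] ∑[ k < n ] term k i₁ j₁ n₁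
    ≡⟨ ∑<-cong (suc i) (λ i₁ _ → trans (∑<-cong (suc j) (λ j₁ _ → ∑<-comm (suc n) n (term′ i₁ j₁)))
                                        (∑<-comm (suc j) n (λ j₁ k → ∑[ n₁ < suc n ] term k i₁ j₁ n₁))) ⟩
  ∑[ i₁ < suc i ] ∑[ k < n ] ∑[ j₁ < suc j ] ∑[ n₁ < suc n ] term k i₁ j₁ n₁
    ≡⟨ ∑<-comm (suc i) n (λ i₁ k → ∑[ j₁ < suc j ] ∑[ n₁ < suc n ] term k i₁ j₁ n₁) ⟩
  ∑[ k < n ] ∑[ i₁ < suc i ] ∑[ j₁ < suc j ] ∑[ n₁ < suc n ] term k i₁ j₁ n₁
    ≡⟨ ∑<-cong n (λ k _ → trans (sym (⊛-as-∑< B (monomial-k k) i j n)) (⊛-monomial B (suc k * α) (suc k * β) (suc k * c) i j n)) ⟩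
  ∑[ k < n ] shift B (suc k * α) (suc k * β) (suc k * c) i j n ∎
  where
  open ≡-Reasoning
  monomial-k : ℕ → Series
  monomial-k k = monomial (suc k * α) (suc k * β) (suc k * c)
  term : ℕ → ℕ → ℕ → ℕ → ℕ
  term k i₁ j₁ n₁ = B i₁ j₁ n₁ * monomial-k k (i ∸ i₁) (j ∸ j₁) (n ∸ n₁)
  term′ : ℕ → ℕ → ℕ → ℕ → ℕ
  term′ i₁ j₁ n₁ k = term k i₁ j₁ n₁

-- Adding a constant to every part

_⊞_ : ℕ × ℕ → ℕ × ℕ → ℕ × ℕ
(a , b) ⊞ (c , d) = a + c , b + d

-- The change of the alternating sum type when k is added to each of m parts.
altShift : ℕ → ℕ → ℕ × ℕ
altShift zero                k = 0 , 0
altShift (suc zero)          k = k , 0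
altShift (suc (suc zero))    k = 0 , k
altShift (suc (suc (suc m))) k = altShift m k

altShift-3*+ : ∀ N r k → altShift (3 * N + r) k ≡ altShift r k
altShift-3*+ zero    r k = refl
altShift-3*+ (suc N) r k = trans (cong (λ m → altShift (m + r) k) (*-suc 3 N)) (altShift-3*+ N r k)

[m+k]∸[n+k]≡m∸n : ∀ m n k → m + k ∸ (n + k) ≡ m ∸ n
[m+k]∸[n+k]≡m∸n m n k = trans (cong₂ _∸_ (+-comm m k) (+-comm n k)) ([m+n]∸[m+o]≡n∸o k m n)

altType-∷∷∷ : ∀ a b c l → altType (a ∷ b ∷ c ∷ l) ≡ (a ∸ b , b ∸ c) ⊞ altType l
altType-∷∷∷ a b c l with altType l
... | _ , _ = refl

altType-∷ʳ-0 : ∀ l → altType (l ++ 0 ∷ []) ≡ altType l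
altType-∷ʳ-0 []              = refl
altType-∷ʳ-0 (a ∷ [])        = refl
altType-∷ʳ-0 (a ∷ b ∷ [])    = cong₂ _,_ (+-identityʳ (a ∸ b)) (+-identityʳ b)
altType-∷ʳ-0 (a ∷ b ∷ c ∷ l) = begin
  altType (a ∷ b ∷ c ∷ l ++ 0 ∷ []) ≡⟨ altType-∷∷∷ a b c (l ++ 0 ∷ []) ⟩
  (a ∸ b , b ∸ c) ⊞ altType (l ++ 0 ∷ []) ≡⟨ cong ((a ∸ b , b ∸ c) ⊞_) (altType-∷ʳ-0 l) ⟩
  (a ∸ b , b ∸ c) ⊞ altType l ≡⟨ altType-∷∷∷ a b c l ⟨
  altType (a ∷ b ∷ c ∷ l) ∎
  where open ≡-Reasoning

altType-++-zeros : ∀ l r → altType (l ++ replicate r 0) ≡ altType l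
altType-++-zeros l zero    = cong altType (++-identityʳ l)
altType-++-zeros l (suc r) = begin
  altType (l ++ 0 ∷ replicate r 0)   ≡⟨ cong altType (++-assoc l (0 ∷ []) (replicate r 0)) ⟨
  altType ((l ++ 0 ∷ []) ++ replicate r 0) ≡⟨ altType-++-zeros (l ++ 0 ∷ []) r ⟩
  altType (l ++ 0 ∷ [])              ≡⟨ altType-∷ʳ-0 l ⟩
  altType l ∎
  where open ≡-Reasoning

altType-map-+ : ∀ k l → altType (map (_+ k) l) ≡ altType l ⊞ altShift (length l) k
altType-map-+ k []              = refl
altType-map-+ k (a ∷ [])        = refl
altType-map-+ k (a ∷ b ∷ [])    = cong₂ _,_ (trans ([m+k]∸[n+k]≡m∸n a b k) (sym (+-identityʳ (a ∸ b)))) refl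
altType-map-+ k (a ∷ b ∷ c ∷ l) = begin
  altType (map (_+ k) (a ∷ b ∷ c ∷ l))
    ≡⟨ altType-∷∷∷ (a + k) (b + k) (c + k) (map (_+ k) l) ⟩
  (a + k ∸ (b + k) , b + k ∸ (c + k)) ⊞ altType (map (_+ k) l)
    ≡⟨ cong₂ _⊞_ (cong₂ _,_ ([m+k]∸[n+k]≡m∸n a b k) ([m+k]∸[n+k]≡m∸n b c k)) (altType-map-+ k l) ⟩
  (a ∸ b , b ∸ c) ⊞ (altType l ⊞ altShift (length l) k)
    ≡⟨ cong₂ _,_ (sym (+-assoc (a ∸ b) _ _)) (sym (+-assoc (b ∸ c) _ _)) ⟩
  ((a ∸ b , b ∸ c) ⊞ altType l) ⊞ altShift (length l) k
    ≡⟨ cong (_⊞ altShift (length l) k) (altType-∷∷∷ a b c l) ⟨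
  altType (a ∷ b ∷ c ∷ l) ⊞ altShift (length (a ∷ b ∷ c ∷ l)) k ∎
  where open ≡-Reasoning

lastPart : List ℕ → ℕ
lastPart []          = 0
lastPart (x ∷ [])    = x
lastPart (x ∷ y ∷ l) = lastPart (y ∷ l)

lastPart-map : ∀ (h : ℕ → ℕ) x l → lastPart (map h (x ∷ l)) ≡ h (lastPart (x ∷ l))
lastPart-map h x []      = refl
lastPart-map h x (y ∷ l) = lastPart-map h y l

lastPart-++ : ∀ l y t → lastPart (l ++ y ∷ t) ≡ lastPart (y ∷ t)
lastPart-++ []          y t = refl
lastPart-++ (a ∷ [])    y t = refl
lastPart-++ (a ∷ b ∷ l) y t = lastPart-++ (b ∷ l) y t

lastPart-replicate : ∀ r x → lastPart (replicate (suc r) x) ≡ x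
lastPart-replicate zero    x = refl
lastPart-replicate (suc r) x = lastPart-replicate r x

lastPart-All : ∀ {P : ℕ → Set} x l → All P (x ∷ l) → P (lastPart (x ∷ l))
lastPart-All x []      (p ∷ _)  = p
lastPart-All x (y ∷ l) (_ ∷ ps) = lastPart-All y l ps

lastPart-minimum : ∀ l → NonIncreasing l → All (lastPart l ≤_) l
lastPart-minimum []          _          = []
lastPart-minimum (x ∷ [])    _          = ≤-refl ∷ []
lastPart-minimum (x ∷ y ∷ l) (x≥y ∷ ni) with lastPart-minimum (y ∷ l) ni
... | p ∷ ps = ≤-trans p x≥y ∷ p ∷ ps

NonIncreasing-map-+ : ∀ k {l} → NonIncreasing l → NonIncreasing (map (_+ k) l)
NonIncreasing-map-+ k ni = Linked.map⁺ (Linked.map (+-monoˡ-≤ k) ni)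

NonIncreasing-map-∸ : ∀ k {l} → NonIncreasing l → NonIncreasing (map (_∸ k) l)
NonIncreasing-map-∸ k ni = Linked.map⁺ (Linked.map (∸-monoˡ-≤ k) ni)

NonIncreasing-replicate-0 : ∀ r → NonIncreasing (replicate r 0)
NonIncreasing-replicate-0 zero          = []
NonIncreasing-replicate-0 (suc zero)    = [-]
NonIncreasing-replicate-0 (suc (suc r)) = ≤-refl ∷ NonIncreasing-replicate-0 (suc r)

NonIncreasing-++-zeros : ∀ l r → NonIncreasing l → NonIncreasing (l ++ replicate r 0)
NonIncreasing-++-zeros []          r       _        = NonIncreasing-replicate-0 r
NonIncreasing-++-zeros (a ∷ [])    zero    _        = [-]
NonIncreasing-++-zeros (a ∷ [])    (suc r) _        = z≤n ∷ NonIncreasing-replicate-0 (suc r)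
NonIncreasing-++-zeros (a ∷ b ∷ l) r       (a≥b ∷ ni) = a≥b ∷ NonIncreasing-++-zeros (b ∷ l) r ni

positivePrefix : List ℕ → List ℕ
positivePrefix []          = []
positivePrefix (zero ∷ _)  = []
positivePrefix (suc x ∷ l) = suc x ∷ positivePrefix l

positivePrefix-positive : ∀ l → All (1 ≤_) (positivePrefix l)
positivePrefix-positive []          = []
positivePrefix-positive (zero ∷ _)  = []
positivePrefix-positive (suc x ∷ l) = s≤s z≤n ∷ positivePrefix-positive l

positivePrefix-++-0∷ : ∀ μ t → All (1 ≤_) μ → positivePrefix (μ ++ 0 ∷ t) ≡ μ
positivePrefix-++-0∷ []          t _        = refl
positivePrefix-++-0∷ (suc x ∷ μ) t (_ ∷ ps) = cong (suc x ∷_) (positivePrefix-++-0∷ μ t ps)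

positivePrefix-NonIncreasing : ∀ l → NonIncreasing l → NonIncreasing (positivePrefix l)
positivePrefix-NonIncreasing []                    _          = []
positivePrefix-NonIncreasing (zero ∷ _)            _          = []
positivePrefix-NonIncreasing (suc x ∷ [])          _          = [-]
positivePrefix-NonIncreasing (suc x ∷ zero ∷ _)    _          = [-]
positivePrefix-NonIncreasing (suc x ∷ suc y ∷ l)   (x≥y ∷ ni) = x≥y ∷ positivePrefix-NonIncreasing (suc y ∷ l) ni

length-positivePrefix< : ∀ x l → lastPart (x ∷ l) ≡ 0 → length (positivePrefix (x ∷ l)) < length (x ∷ l)
length-positivePrefix< zero    l       _    = s≤s z≤n
length-positivePrefix< (suc x) []      ()
length-positivePrefix< (suc x) (y ∷ l) last = s≤s (length-positivePrefix< y l last)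

pad : ℕ → List ℕ → List ℕ
pad m μ = μ ++ replicate (m ∸ length μ) 0

NonIncreasing⇒pad-positivePrefix : ∀ l → NonIncreasing l → pad (length l) (positivePrefix l) ≡ l
NonIncreasing⇒pad-positivePrefix []          _  = refl
NonIncreasing⇒pad-positivePrefix (zero ∷ l)  ni = cong (0 ∷_) (sym (zeros l ni))
  where
  zeros : ∀ l → NonIncreasing (0 ∷ l) → l ≡ replicate (length l) 0
  zeros []          _               = refl
  zeros (zero ∷ l)  (_ ∷ ni)        = cong (0 ∷_) (zeros l ni)
  zeros (suc y ∷ l) (() ∷ _)
NonIncreasing⇒pad-positivePrefix (suc x ∷ l) ni =
  cong (suc x ∷_) (NonIncreasing⇒pad-positivePrefix l (Linked.tail ni))

length-pad : ∀ m μ → length μ ≤ m → length (pad m μ) ≡ m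
length-pad m μ len≤ = trans (length-++ μ) (trans (cong (length μ +_) (length-replicate (m ∸ length μ))) (m+[n∸m]≡n len≤))

sum-++-zeros : ∀ l r → sum (l ++ replicate r 0) ≡ sum l
sum-++-zeros l r = trans (sum-++ l (replicate r 0)) (trans (cong (sum l +_) (zeros r)) (+-identityʳ (sum l)))
  where
  zeros : ∀ r → sum (replicate r 0) ≡ 0
  zeros zero    = refl
  zeros (suc r) = zeros r

sum-map-+ : ∀ k l → sum (map (_+ k) l) ≡ sum l + length l * k
sum-map-+ k []      = refl
sum-map-+ k (a ∷ l) = trans (cong (a + k +_) (sum-map-+ k l)) (interchange a k (sum l) (length l * k))

decompose : List ℕ → ℕ × List ℕ
decompose x = lastPart x , positivePrefix (map (_∸ lastPart x) x)

compose : ℕ → ℕ × List ℕ → List ℕ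
compose m (k , μ) = map (_+ k) (pad m μ)

compose-decompose : ∀ x → NonIncreasing x → compose (length x) (decompose x) ≡ x
compose-decompose x ni = begin
  map (_+ k) (pad (length x) (positivePrefix ν))
    ≡⟨ cong (λ m → map (_+ k) (pad m (positivePrefix ν))) (length-map (_∸ k) x) ⟨
  map (_+ k) (pad (length ν) (positivePrefix ν))
    ≡⟨ cong (map (_+ k)) (NonIncreasing⇒pad-positivePrefix ν (NonIncreasing-map-∸ k ni)) ⟩
  map (_+ k) (map (_∸ k) x)
    ≡⟨ add-sub (lastPart-minimum x ni) ⟩
  x ∎
  where
  open ≡-Reasoning
  k = lastPart x
  ν = map (_∸ k) x
  add-sub : ∀ {y} → All (k ≤_) y → map (_+ k) (map (_∸ k) y) ≡ y
  add-sub []       = refl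
  add-sub (p ∷ ps) = cong₂ _∷_ (m∸n+n≡m p) (add-sub ps)

length-decompose< : ∀ a l → length (proj₂ (decompose (a ∷ l))) < length (a ∷ l)
length-decompose< a l = subst (length (proj₂ (decompose (a ∷ l))) <_) (length-map (_∸ k) (a ∷ l))
  (length-positivePrefix< (a ∸ k) (map (_∸ k) l) (trans (lastPart-map (_∸ k) a l) (n∸n≡0 k)))
  where k = lastPart (a ∷ l)

pad-< : ∀ m μ → length μ < m → ∃[ r ] pad m μ ≡ μ ++ 0 ∷ replicate r 0
pad-< m μ len< with m ∸ length μ | m<n⇒0<n∸m len<
... | suc r | _ = r , refl

lastPart-compose : ∀ m k μ → length μ < m → lastPart (compose m (k , μ)) ≡ k
lastPart-compose m k μ len< with pad-< m μ len<
... | r , padded = begin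
  lastPart (map (_+ k) (pad m μ))                    ≡⟨ cong (lastPart ∘ map (_+ k)) padded ⟩
  lastPart (map (_+ k) (μ ++ 0 ∷ replicate r 0))     ≡⟨ cong lastPart (map-++ (_+ k) μ (0 ∷ replicate r 0)) ⟩
  lastPart (map (_+ k) μ ++ k ∷ map (_+ k) (replicate r 0)) ≡⟨ lastPart-++ (map (_+ k) μ) k _ ⟩
  lastPart (map (_+ k) (0 ∷ replicate r 0))          ≡⟨ lastPart-map (_+ k) 0 (replicate r 0) ⟩
  lastPart (replicate (suc r) 0) + k                 ≡⟨ cong (_+ k) (lastPart-replicate r 0) ⟩
  k ∎
  where open ≡-Reasoning

decompose-compose : ∀ m k μ → All (1 ≤_) μ → length μ < m → decompose (compose m (k , μ)) ≡ (k , μ)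
decompose-compose m k μ pos len< = begin
  decompose (compose m (k , μ))
    ≡⟨ cong (λ k′ → k′ , positivePrefix (map (_∸ k′) (compose m (k , μ)))) (lastPart-compose m k μ len<) ⟩
  k , positivePrefix (map (_∸ k) (map (_+ k) (pad m μ)))
    ≡⟨ cong (λ l → k , positivePrefix l) (trans (sub-add (pad m μ)) (proj₂ (pad-< m μ len<))) ⟩
  k , positivePrefix (μ ++ 0 ∷ replicate (proj₁ (pad-< m μ len<)) 0)
    ≡⟨ cong (k ,_) (positivePrefix-++-0∷ μ _ pos) ⟩
  k , μ ∎
  where
  open ≡-Reasoning
  sub-add : ∀ y → map (_∸ k) (map (_+ k) y) ≡ y
  sub-add []      = refl
  sub-add (a ∷ y) = cong₂ _∷_ (m+n∸n≡m a k) (sub-add y)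

compose-as-++ : ∀ m k μ → compose m (k , μ) ≡ map (_+ k) μ ++ replicate (m ∸ length μ) k
compose-as-++ m k μ = trans (map-++ (_+ k) μ _) (cong (map (_+ k) μ ++_) (map-replicate (_+ k) (m ∸ length μ) 0))

length-compose : ∀ m k μ → length μ ≤ m → length (compose m (k , μ)) ≡ m
length-compose m k μ len≤ = trans (length-map (_+ k) (pad m μ)) (length-pad m μ len≤)

sum-compose : ∀ m k μ → length μ ≤ m → sum (compose m (k , μ)) ≡ sum μ + k * m
sum-compose m k μ len≤ = begin
  sum (map (_+ k) (pad m μ))           ≡⟨ sum-map-+ k (pad m μ) ⟩
  sum (pad m μ) + length (pad m μ) * k ≡⟨ cong₂ _+_ (sum-++-zeros μ (m ∸ length μ)) (cong (_* k) (length-pad m μ len≤)) ⟩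
  sum μ + m * k                        ≡⟨ cong (sum μ +_) (*-comm m k) ⟩
  sum μ + k * m ∎
  where open ≡-Reasoning

altType-compose : ∀ m k μ → length μ ≤ m → altType (compose m (k , μ)) ≡ altType μ ⊞ altShift m k
altType-compose m k μ len≤ = begin
  altType (map (_+ k) (pad m μ))                       ≡⟨ altType-map-+ k (pad m μ) ⟩
  altType (pad m μ) ⊞ altShift (length (pad m μ)) k    ≡⟨ cong₂ (λ t m′ → t ⊞ altShift m′ k) (altType-++-zeros μ (m ∸ length μ)) (length-pad m μ len≤) ⟩
  altType μ ⊞ altShift m k ∎
  where open ≡-Reasoning

NonIncreasing-compose : ∀ m k μ → NonIncreasing μ → NonIncreasing (compose m (k , μ))
NonIncreasing-compose m k μ ni = NonIncreasing-map-+ k (NonIncreasing-++-zeros μ (m ∸ length μ) ni)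

occ-++ : ∀ x l t → occ x (l ++ t) ≡ occ x l + occ x t
occ-++ x l t = trans (cong length (filter-++ (x ≟_) l t)) (length-++ (filter (x ≟_) l))

occ-map-+ : ∀ e k μ → occ (e + k) (map (_+ k) μ) ≡ occ e μ
occ-map-+ e k μ = begin
  occ (e + k) (map (_+ k) μ)                       ≡⟨ length-filter-as-sum (e + k ≟_) (map (_+ k) μ) ⟩
  sum (map (λ y → [ e + k ≟ y ]) (map (_+ k) μ))   ≡⟨ sum-map-∘ _ (_+ k) μ ⟩
  sum (map (λ y → [ e + k ≟ y + k ]) μ)            ≡⟨ cong sum (map-cong-local (All.universal (λ y →
                                                        indicator-cong (e + k ≟ y + k) (e ≟ y) (+-cancelʳ-≡ k e y) (cong (_+ k))) μ)) ⟩
  sum (map (λ y → [ e ≟ y ]) μ)                    ≡⟨ length-filter-as-sum (e ≟_) μ ⟨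
  occ e μ ∎
  where open ≡-Reasoning

occ-compose-shifted : ∀ m k μ e → 1 ≤ e → occ (e + k) (compose m (k , μ)) ≡ occ e μ
occ-compose-shifted m k μ e@(suc _) _ = begin
  occ (e + k) (compose m (k , μ))
    ≡⟨ cong (occ (e + k)) (compose-as-++ m k μ) ⟩
  occ (e + k) (map (_+ k) μ ++ replicate (m ∸ length μ) k)
    ≡⟨ occ-++ (e + k) (map (_+ k) μ) _ ⟩
  occ (e + k) (map (_+ k) μ) + occ (e + k) (replicate (m ∸ length μ) k)
    ≡⟨ cong₂ _+_ (occ-map-+ e k μ)
                 (cong length (filter-none (e + k ≟_) (All.replicate⁺ (m ∸ length μ) (m≢1+n+m k ∘ sym)))) ⟩
  occ e μ + 0
    ≡⟨ +-identityʳ (occ e μ) ⟩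
  occ e μ ∎
  where open ≡-Reasoning

occ-compose-smallest : ∀ m k μ → All (1 ≤_) μ → occ k (compose m (k , μ)) ≡ m ∸ length μ
occ-compose-smallest m k μ pos = begin
  occ k (compose m (k , μ))
    ≡⟨ cong (occ k) (compose-as-++ m k μ) ⟩
  occ k (map (_+ k) μ ++ replicate (m ∸ length μ) k)
    ≡⟨ occ-++ k (map (_+ k) μ) _ ⟩
  occ k (map (_+ k) μ) + occ k (replicate (m ∸ length μ) k)
    ≡⟨ cong₂ _+_ (cong length (filter-none (k ≟_) (All.map⁺ (All.map (λ { (s≤s z≤n) → m≢1+n+m k }) pos))))
                 (trans (cong length (filter-all (k ≟_) (All.replicate⁺ (m ∸ length μ) refl))) (length-replicate (m ∸ length μ))) ⟩
  m ∸ length μ ∎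
  where open ≡-Reasoning

AtMostTwice-compose⁺ : ∀ m k μ → All (1 ≤_) μ → m ∸ length μ ≤ 2 → AtMostTwice μ → AtMostTwice (compose m (k , μ))
AtMostTwice-compose⁺ m k μ pos r≤2 amt = subst (All (λ x → occ x (compose m (k , μ)) ≤ 2)) (sym (compose-as-++ m k μ))
  (All.++⁺ (All.map⁺ (All.zipWith (λ { (1≤e , occ≤2) → subst (_≤ 2) (sym (occ-compose-shifted m k μ _ 1≤e)) occ≤2 }) (pos , amt)))
           (All.replicate⁺ (m ∸ length μ) (subst (_≤ 2) (sym (occ-compose-smallest m k μ pos)) r≤2)))

AtMostTwice-compose⁻ : ∀ m k μ → All (1 ≤_) μ → length μ < m → AtMostTwice (compose m (k , μ)) →
  AtMostTwice μ × m ∸ length μ ≤ 2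
AtMostTwice-compose⁻ m k μ pos len< amt =
  All.zipWith (λ { (1≤e , occ≤2) → subst (_≤ 2) (occ-compose-shifted m k μ _ 1≤e) occ≤2 }) (pos , All.map⁻ (proj₁ parts)) ,
  subst (_≤ 2) (occ-compose-smallest m k μ pos) (head-replicate (m<n⇒0<n∸m len<) (proj₂ parts))
  where
  parts = All.++⁻ (map (_+ k) μ) (subst (All (λ x → occ x (compose m (k , μ)) ≤ 2)) (compose-as-++ m k μ) amt)
  head-replicate : ∀ {P : ℕ → Set} {r} → 0 < r → All P (replicate r k) → P k
  head-replicate {r = suc _} _ (p ∷ _) = p

_≟ᴾ_ : DecidableEquality (ℕ × List ℕ)
_≟ᴾ_ = ×-≡-dec _≟_ _≟ᴸ_

pairs : ℕ → ℕ → ℕ → List (ℕ × List ℕ)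
pairs n m₁ m₂ = concatMap (λ k → map (k ,_) (lists m₁ n ++ lists m₂ n)) (range1 n)

InPairs : ℕ → ℕ → ℕ → ℕ × List ℕ → Set
InPairs n m₁ m₂ (k , μ) = (1 ≤ k × k ≤ n) × (InLists m₁ n μ ⊎ InLists m₂ n μ)

pairs-sound : ∀ n m₁ m₂ → All (InPairs n m₁ m₂) (pairs n m₁ m₂)
pairs-sound n m₁ m₂ = All.concat⁺ (All.map⁺ (All.map⁺ (All.applyUpTo⁺₁ (λ k → k) n (λ k<n →
  All.map⁺ (All.++⁺ (All.map (λ inL → (s≤s z≤n , k<n) , inj₁ inL) (lists-sound m₁ n))
                    (All.map (λ inL → (s≤s z≤n , k<n) , inj₂ inL) (lists-sound m₂ n)))))))

sum-map-pairs : ∀ n m₁ m₂ (h : ℕ × List ℕ → ℕ) → sum (map h (pairs n m₁ m₂)) ≡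
  ∑[ k < n ] (sum (map (λ μ → h (suc k , μ)) (lists m₁ n)) + sum (map (λ μ → h (suc k , μ)) (lists m₂ n)))
sum-map-pairs n m₁ m₂ h = trans (sum-map-concatMap h _ (range1 n)) (trans (sum-map-range1 _ n) (∑<-cong n (λ k _ →
  trans (sum-map-∘ h (suc k ,_) (lists m₁ n ++ lists m₂ n)) (sum-map-++ _ (lists m₁ n) (lists m₂ n)))))

multiplicity-pairs : ∀ n m₁ m₂ → m₁ ≢ m₂ → ∀ y → InPairs n m₁ m₂ y → multiplicity _≟ᴾ_ (pairs n m₁ m₂) y ≡ 1
multiplicity-pairs n m₁ m₂ m₁≢m₂ (k , μ) ((1≤k , k≤n) , inLists) = begin
  multiplicity _≟ᴾ_ (pairs n m₁ m₂) (k , μ)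
    ≡⟨ sum-map-pairs n m₁ m₂ _ ⟩
  ∑[ k′ < n ] (multiplicity′ k′ m₁ + multiplicity′ k′ m₂)
    ≡⟨ ∑<-cong n (λ k′ _ → trans (cong₂ _+_ (factor k′ m₁) (factor k′ m₂)) (sym (*-distribˡ-+ [ suc k′ ≟ k ] _ _))) ⟩
  ∑[ k′ < n ] ([ suc k′ ≟ k ] * (multiplicity _≟ᴸ_ (lists m₁ n) μ + multiplicity _≟ᴸ_ (lists m₂ n) μ))
    ≡⟨ ∑<-cong n (λ k′ _ → cong ([ suc k′ ≟ k ] *_) (exactly-one inLists)) ⟩
  ∑[ k′ < n ] ([ suc k′ ≟ k ] * 1)
    ≡⟨ ∑<-pick-suc n k 1 1≤k k≤n ⟩
  1 ∎
  where
  open ≡-Reasoning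
  multiplicity′ : ℕ → ℕ → ℕ
  multiplicity′ k′ m′ = sum (map (λ μ′ → [ (suc k′ , μ′) ≟ᴾ (k , μ) ]) (lists m′ n))
  factor : ∀ k′ m′ → multiplicity′ k′ m′ ≡ [ suc k′ ≟ k ] * multiplicity _≟ᴸ_ (lists m′ n) μ
  factor k′ m′ = trans (cong sum (map-cong-local (All.universal (λ μ′ →
      trans (indicator-cong ((suc k′ , μ′) ≟ᴾ (k , μ)) ((suc k′ ≟ k) ×-dec (μ′ ≟ᴸ μ))
                            (λ { refl → refl , refl }) (λ { (refl , refl) → refl }))
            (indicator-× (suc k′ ≟ k) (μ′ ≟ᴸ μ))) (lists m′ n))))
    (sym (*-distribˡ-sum-map [ suc k′ ≟ k ] _ (lists m′ n)))
  exactly-one : InLists m₁ n μ ⊎ InLists m₂ n μ →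
    multiplicity _≟ᴸ_ (lists m₁ n) μ + multiplicity _≟ᴸ_ (lists m₂ n) μ ≡ 1
  exactly-one (inj₁ in₁) = cong₂ _+_ (multiplicity-lists m₁ n μ in₁)
                                     (multiplicity-lists-length m₂ n μ (m₁≢m₂ ∘ trans (sym (proj₁ in₁))))
  exactly-one (inj₂ in₂) = cong₂ _+_ (multiplicity-lists-length m₁ n μ (λ e → m₁≢m₂ (trans (sym e) (proj₁ in₂))))
                                     (multiplicity-lists m₂ n μ in₂)

-- The recurrence

+≡⇒≡∸ : ∀ {a b c} → a + b ≡ c → a ≡ c ∸ b
+≡⇒≡∸ {a} {b} refl = sym (m+n∸n≡m a b)

+≡⇒≤ˡ : ∀ {a b c} → a + b ≡ c → a ≤ c
+≡⇒≤ˡ {a} {b} refl = m≤m+n a b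

+≡⇒≤ʳ : ∀ {a b c} → a + b ≡ c → b ≤ c
+≡⇒≤ʳ {a} {b} refl = m≤n+m b a

≡∸⇒+≡ : ∀ {a b c} → b ≤ c → a ≡ c ∸ b → a + b ≡ c
≡∸⇒+≡ b≤c refl = m∸n+n≡m b≤c

parts-bounded : ∀ {n} l → sum l ≤ n → All (1 ≤_) l → All (λ e → 1 ≤ e × e ≤ n) l
parts-bounded l sum≤n pos = All.zip (pos , All.map (λ e≤ → ≤-trans e≤ sum≤n) (parts≤sum l))

≡m∸⇒bounds : ∀ {m d ℓ} → 1 ≤ d → d ≤ 2 → d ≤ m → ℓ ≡ m ∸ d → ℓ < m × m ∸ ℓ ≤ 2
≡m∸⇒bounds {m} {d} 1≤d d≤2 d≤m refl = ∸-monoʳ-< {m} {d} {0} 1≤d d≤m , subst (_≤ 2) (sym (m∸[m∸n]≡n d≤m)) d≤2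

module Decomposition (m α β : ℕ) (3≤m : 3 ≤ m) (altShift-m : ∀ k → altShift m k ≡ (k * α , k * β)) (i j n : ℕ) where

  Fits : ℕ → Set
  Fits k = k * α ≤ i × k * β ≤ j × k * m ≤ n

  -- Fits k makes the truncated subtractions in Reduced exact.
  Reduced : ℕ × List ℕ → Set
  Reduced (k , μ) = Fits k × Good (i ∸ k * α) (j ∸ k * β) (n ∸ k * m) μ

  decompose-Good : ∀ x → InLists m n x → Good i j n x →
    InPairs n (m ∸ 1) (m ∸ 2) (decompose x) × Reduced (decompose x) × compose m (decompose x) ≡ x
  decompose-Good [] (len , _) _ with subst (3 ≤_) (sym len) 3≤m
  ... | ()
  decompose-Good x@(a ∷ t) (len , entries) (ni , sum≡ , amt , alt≡) =
    (lastPart-All a t entries , length-choice (proj₂ amt′)) ,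
    ((+≡⇒≤ʳ alt₁ , +≡⇒≤ʳ alt₂ , +≡⇒≤ʳ sum′) ,
     (positivePrefix-NonIncreasing _ (NonIncreasing-map-∸ k ni) , +≡⇒≡∸ sum′ , proj₁ amt′ ,
      cong₂ _,_ (+≡⇒≡∸ alt₁) (+≡⇒≡∸ alt₂))) ,
    composed
    where
    k = proj₁ (decompose x)
    μ = proj₂ (decompose x)
    pos : All (1 ≤_) μ
    pos = positivePrefix-positive _
    len< : length μ < m
    len< = subst (length μ <_) len (length-decompose< a t)
    composed : compose m (k , μ) ≡ x
    composed = subst (λ m′ → compose m′ (k , μ) ≡ x) len (compose-decompose x ni)
    sum′ : sum μ + k * m ≡ n
    sum′ = trans (sym (sum-compose m k μ (<⇒≤ len<))) (trans (cong sum composed) sum≡)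
    alt′ : altType μ ⊞ (k * α , k * β) ≡ (i , j)
    alt′ = trans (cong (altType μ ⊞_) (sym (altShift-m k)))
                 (trans (sym (altType-compose m k μ (<⇒≤ len<))) (trans (cong altType composed) alt≡))
    alt₁ : proj₁ (altType μ) + k * α ≡ i
    alt₁ = cong proj₁ alt′
    alt₂ : proj₂ (altType μ) + k * β ≡ j
    alt₂ = cong proj₂ alt′
    amt′ : AtMostTwice μ × m ∸ length μ ≤ 2
    amt′ = AtMostTwice-compose⁻ m k μ pos len< (subst AtMostTwice (sym composed) amt)
    length-choice : m ∸ length μ ≤ 2 → InLists (m ∸ 1) n μ ⊎ InLists (m ∸ 2) n μ
    length-choice r≤2 with m ∸ length μ | m<n⇒0<n∸m len< | m∸[m∸n]≡n (<⇒≤ len<)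
    ... | 1 | _ | len≡ = inj₁ (sym len≡ , parts-bounded μ (+≡⇒≤ˡ sum′) pos)
    ... | 2 | _ | len≡ = inj₂ (sym len≡ , parts-bounded μ (+≡⇒≤ˡ sum′) pos)
    ... | suc (suc (suc _)) | _ | _ = ⊥-elim (<⇒≱ (s≤s (s≤s (s≤s z≤n))) r≤2)

  compose-Reduced : ∀ y → InPairs n (m ∸ 1) (m ∸ 2) y → Reduced y →
    InLists m n (compose m y) × Good i j n (compose m y) × decompose (compose m y) ≡ y
  compose-Reduced (k , μ) ((1≤k , _) , inLists) ((kα≤i , kβ≤j , km≤n) , (ni , sum≡ , amt , alt≡)) =
    (length-compose m k μ (<⇒≤ len<) , parts-bounded x (≤-reflexive sum-x) entries-pos) ,
    (NonIncreasing-compose m k μ ni , sum-x , AtMostTwice-compose⁺ m k μ pos r≤2 amt , alt-x) ,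
    decompose-compose m k μ pos len<
    where
    x = compose m (k , μ)
    entries = [ proj₂ , proj₂ ]′ inLists
    pos : All (1 ≤_) μ
    pos = All.map proj₁ entries
    entries-pos : All (1 ≤_) x
    entries-pos = All.map⁺ (All.universal (λ e → ≤-trans 1≤k (m≤n+m k e)) (pad m μ))
    length-bounds : InLists (m ∸ 1) n μ ⊎ InLists (m ∸ 2) n μ → length μ < m × m ∸ length μ ≤ 2
    length-bounds (inj₁ (len , _)) = ≡m∸⇒bounds (s≤s z≤n) (s≤s z≤n) (≤-trans (s≤s z≤n) 3≤m) len
    length-bounds (inj₂ (len , _)) = ≡m∸⇒bounds (s≤s z≤n) ≤-refl (≤-trans (s≤s (s≤s z≤n)) 3≤m) len
    len< = proj₁ (length-bounds inLists)
    r≤2 = proj₂ (length-bounds inLists)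
    sum-x : sum x ≡ n
    sum-x = trans (sum-compose m k μ (<⇒≤ len<)) (≡∸⇒+≡ km≤n sum≡)
    alt-x : altType x ≡ (i , j)
    alt-x = trans (altType-compose m k μ (<⇒≤ len<))
                  (trans (cong₂ _⊞_ alt≡ (altShift-m k)) (cong₂ _,_ (m∸n+n≡m kα≤i) (m∸n+n≡m kβ≤j)))

  fits? : ∀ k → Dec (Fits k)
  fits? k = (k * α ≤? i) ×-dec ((k * β ≤? j) ×-dec (k * m ≤? n))

  reduced? : ∀ y → Dec (Reduced y)
  reduced? (k , μ) = fits? k ×-dec good? (i ∸ k * α) (j ∸ k * β) (n ∸ k * m) μ

  count-Reduced : ∀ m′ k → sum (map (λ μ → [ reduced? (k , μ) ]) (lists (suc m′) n)) ≡
    [ fits? k ] * A (suc m′) (i ∸ k * α) (j ∸ k * β) (n ∸ k * m)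
  count-Reduced m′ k = begin
    sum (map (λ μ → [ reduced? (k , μ) ]) (lists (suc m′) n))
      ≡⟨ cong sum (map-cong-local (All.universal (λ μ → indicator-× (fits? k) (good? (i ∸ k * α) (j ∸ k * β) (n ∸ k * m) μ)) (lists (suc m′) n))) ⟩
    sum (map (λ μ → [ fits? k ] * [ good? (i ∸ k * α) (j ∸ k * β) (n ∸ k * m) μ ]) (lists (suc m′) n))
      ≡⟨ *-distribˡ-sum-map [ fits? k ] _ (lists (suc m′) n) ⟨
    [ fits? k ] * sum (map (λ μ → [ good? (i ∸ k * α) (j ∸ k * β) (n ∸ k * m) μ ]) (lists (suc m′) n))
      ≡⟨ cong ([ fits? k ] *_) (A-suc-count m′ _ _ (m∸n≤m n (k * m))) ⟨
    [ fits? k ] * A (suc m′) (i ∸ k * α) (j ∸ k * β) (n ∸ k * m) ∎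
    where open ≡-Reasoning

  indicator-fits : ∀ k b → [ fits? k ] * b ≡ [ k * α ≤? i ] * ([ k * β ≤? j ] * ([ k * m ≤? n ] * b))
  indicator-fits k b = begin
    [ fits? k ] * b
      ≡⟨ cong (_* b) (trans (indicator-× (k * α ≤? i) ((k * β ≤? j) ×-dec (k * m ≤? n))) (cong ([ k * α ≤? i ] *_) (indicator-× (k * β ≤? j) (k * m ≤? n)))) ⟩
    [ k * α ≤? i ] * ([ k * β ≤? j ] * [ k * m ≤? n ]) * b
      ≡⟨ *-assoc [ k * α ≤? i ] _ b ⟩
    [ k * α ≤? i ] * ([ k * β ≤? j ] * [ k * m ≤? n ] * b)
      ≡⟨ cong ([ k * α ≤? i ] *_) (*-assoc [ k * β ≤? j ] _ b) ⟩
    [ k * α ≤? i ] * ([ k * β ≤? j ] * ([ k * m ≤? n ] * b)) ∎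
    where open ≡-Reasoning

A-recurrence : ∀ m α β → 3 ≤ m → (∀ k → altShift m k ≡ (k * α , k * β)) →
  A m ≈ ((A (m ∸ 1) ⊕ A (m ∸ 2)) ⊛ geom α β m)
A-recurrence m@(suc (suc (suc m₀))) α β 3≤m altShift-m i j n = begin
  A m i j n
    ≡⟨ A-suc-count (suc (suc m₀)) i j {n} ≤-refl ⟩
  sum (map (λ x → [ good? i j n x ]) (lists m n))
    ≡⟨ count-bijection _≟ᴸ_ _≟ᴾ_ (lists-sound m n) (pairs-sound n m₁ m₂) (good? i j n) reduced? decompose (compose m)
         (λ x inL G → let (inP , R , composed) = decompose-Good x inL G in
                      R , composed , multiplicity-pairs n m₁ m₂ (λ ()) _ inP)
         (λ y inP R → let (inL , G , decomposed) = compose-Reduced y inP R in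
                      G , decomposed , multiplicity-lists m n _ inL) ⟩
  sum (map (λ y → [ reduced? y ]) (pairs n m₁ m₂))
    ≡⟨ sum-map-pairs n m₁ m₂ _ ⟩
  ∑[ k < n ] (sum (map (λ μ → [ reduced? (suc k , μ) ]) (lists m₁ n)) + sum (map (λ μ → [ reduced? (suc k , μ) ]) (lists m₂ n)))
    ≡⟨ ∑<-cong n (λ k _ → trans (cong₂ _+_ (count-Reduced (suc m₀) (suc k)) (count-Reduced m₀ (suc k)))
                                (trans (sym (*-distribˡ-+ [ fits? (suc k) ] _ _)) (indicator-fits (suc k) _))) ⟩
  ∑[ k < n ] shift (A m₁ ⊕ A m₂) (suc k * α) (suc k * β) (suc k * m) i j n
    ≡⟨ ⊛-geom (A m₁ ⊕ A m₂) α β m (s≤s z≤n) i j n ⟨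
  ((A m₁ ⊕ A m₂) ⊛ geom α β m) i j n ∎
  where
  open ≡-Reasoning
  m₁ = suc (suc m₀)
  m₂ = suc m₀
  open Decomposition m α β 3≤m altShift-m i j n
A-recurrence (suc zero)       _ _ (s≤s ())
A-recurrence (suc (suc zero)) _ _ (s≤s (s≤s ()))

lemma4p2 : (N : ℕ) → 1 ≤ N →
    (A (3 * N) ≈ ((A (3 * N ∸ 1) ⊕ A (3 * N ∸ 2)) ⊛ geom 0 0 (3 * N)))
    × (A (3 * N + 1) ≈ ((A (3 * N) ⊕ A (3 * N ∸ 1)) ⊛ geom 1 0 (3 * N + 1)))
    × (A (3 * N + 2) ≈ ((A (3 * N + 1) ⊕ A (3 * N)) ⊛ geom 0 1 (3 * N + 2)))
lemma4p2 N 1≤N =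
  subst (λ m → A m ≈ ((A (m ∸ 1) ⊕ A (m ∸ 2)) ⊛ geom 0 0 m)) (+-identityʳ (3 * N))
    (step 0 0 0 (λ k → sym (cong₂ _,_ (*-zeroʳ k) (*-zeroʳ k)))) ,
  subst₂ (λ p q → A (3 * N + 1) ≈ ((A p ⊕ A q) ⊛ geom 1 0 (3 * N + 1)))
    (m+n∸n≡m (3 * N) 1) (cong (_∸ 2) (+-comm (3 * N) 1))
    (step 1 1 0 (λ k → sym (cong₂ _,_ (*-identityʳ k) (*-zeroʳ k)))) ,
  subst₂ (λ p q → A (3 * N + 2) ≈ ((A p ⊕ A q) ⊛ geom 0 1 (3 * N + 2)))
    (trans (cong (_∸ 1) (+-comm (3 * N) 2)) (+-comm 1 (3 * N))) (m+n∸n≡m (3 * N) 2)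
    (step 2 0 1 (λ k → sym (cong₂ _,_ (*-zeroʳ k) (*-identityʳ k))))
  where
  step : ∀ r α β → (∀ k → altShift r k ≡ (k * α , k * β)) →
    A (3 * N + r) ≈ ((A (3 * N + r ∸ 1) ⊕ A (3 * N + r ∸ 2)) ⊛ geom α β (3 * N + r))
  step r α β altShift-r = A-recurrence (3 * N + r) α β (≤-trans (*-monoʳ-≤ 3 1≤N) (m≤m+n (3 * N) r))
                                       (λ k → trans (altShift-3*+ N r k) (altShift-r k))
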